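{- Let $G=(V,E)$ be a finite digraph and $w\in V^*$. Then $w$ fixes the independent network $I_G$ if and only if the set $[w]$ of vertices occurring in $w$ is a directed vertex cover of $G$.
   Context: A digraph is $G=(V,E)$ with $E\subseteq V^2\setminus\{(v,v)\}$; $u\to v$ means $(u,v)\in E$. An edge $(u,v)$ is symmetric if $(v,u)\in E$ too, and oriented otherwise. The independent network is $I_G(x)_v=x_v\wedge\bigwedge_{u\to v}\neg x_u$ for $x\in\{0,1\}^V$ (equal to $x_v$ if $v$ has no in-neighbours). $I_G^v$ updates only coordinate $v$ to $I_G(x)_v$; for a word $w=w_1\dots w_l$, $I_G^w=I_G^{w_l}\circ\dots\circ I_G^{w_1}$. A word $w$ fixes $I_G$ if $I_G^w(x)$ is a fixed point of $I_G$ (equivalently the characteristic vector of an independent set, i.e. a set containing no edge) for every $x$. A directed vertex cover is a set $S\subseteq V$ such that every symmetric edge has at least one endpoint in $S$ and for every oriented edge $(u,v)$, $v\in S$. -}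

module Defs where

open import Data.Nat using (ℕ)
open import Data.Fin using (Fin)
open import Data.Fin.Properties using (_≟_)
open import Data.Bool using (Bool; true; false; _∧_; not; if_then_else_)
open import Data.List using (List; []; _∷_)
import Data.List
open import Data.List.Membership.Propositional using (_∈_)
open import Data.Product using (_×_)
open import Data.Sum using (_⊎_)
open import Relation.Nullary using (¬_; does)
open import Relation.Binary.PropositionalEquality using (_≡_)

record Digraph (n : ℕ) : Set where
  field
    edge    : Fin n → Fin n → Bool
    irrefl  : ∀ v → edge v v ≡ false

open Digraph public

_⟶[_]_ : ∀ {n} → Fin n → Digraph n → Fin n → Set
u ⟶[ G ] v = edge G u v ≡ true

Config : ℕ → Set
Config n = Fin n → Bool

⋀ : ∀ {n} → (Fin n → Bool) → Bool
⋀ {n} f = Data.List.foldr (λ i b → f i ∧ b) true (Data.List.allFin n)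

I : ∀ {n} → Digraph n → Config n → Config n
I G x v = x v ∧ ⋀ (λ u → not (edge G u v ∧ x u))

Iat : ∀ {n} → Digraph n → Fin n → Config n → Config n
Iat G v x u = if does (u ≟ v) then I G x v else x u

-- I_G^w = I^{w_l} ∘ … ∘ I^{w_1}  (w_1 applied first)
Iword : ∀ {n} → Digraph n → List (Fin n) → Config n → Config n
Iword G []      x = x
Iword G (v ∷ w) x = Iword G w (Iat G v x)

IsFixed : ∀ {n} → Digraph n → Config n → Set
IsFixed G x = ∀ v → I G x v ≡ x v

Fixes : ∀ {n} → List (Fin n) → Digraph n → Set
Fixes w G = ∀ x → IsFixed G (Iword G w x)

IsDirectedVertexCover : ∀ {n} → Digraph n → (Fin n → Set) → Set
IsDirectedVertexCover G S =
  (∀ u v → u ⟶[ G ] v → v ⟶[ G ] u → S u ⊎ S v)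
  × (∀ u v → u ⟶[ G ] v → ¬ (v ⟶[ G ] u) → S v)

occurs : ∀ {n} → List (Fin n) → Fin n → Set
occurs w v = v ∈ w

{-# OPTIONS --safe #-}
module Submission where

-- Updating v switches v off unless all its in-neighbours are off, and no update
-- ever switches a vertex on; so once the head v of an edge u → v has been updated,
-- u and v are never on together again.  A directed vertex cover [w] updates the
-- head of every oriented edge and some endpoint of every symmetric edge, so every
-- edge ends up half-empty.  Conversely, if u → v is an edge with v ∉ [w] and
-- either u ∉ [w] or v ↛ u, the configuration with exactly u and v on is left
-- unchanged by every letter of w, although it is not independent.

open import Defs
open import Data.Nat using (ℕ)
open import Data.Fin using (Fin)
open import Data.Fin.Properties using (_≟_)
open import Data.Bool using (Bool; true; false; _∧_; _∨_; not)
open import Data.Bool.Properties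
  using (∧-conicalˡ; ∧-conicalʳ; ∨-zeroʳ; not-injective; not-¬; ¬-not)
  renaming (_≟_ to _≟ᵇ_)
open import Data.Empty using (⊥)
open import Data.List using (List; []; _∷_; foldr; allFin)
open import Data.List.Membership.Propositional using (_∈_; _∉_)
open import Data.List.Membership.Propositional.Properties using (∈-allFin)
open import Data.List.Relation.Unary.Any using (here; there)
open import Data.Product using (_×_; _,_; proj₁; proj₂)
open import Data.Sum using (_⊎_; inj₁; inj₂; [_,_])
open import Function using (flip; id)
open import Function.Bundles using (_⇔_; mk⇔)
open import Relation.Nullary using (¬_; yes; no; does; contradiction)
open import Relation.Nullary.Decidable using (dec-true; dec-false; decidable-stable)
open import Relation.Binary.PropositionalEquality
  using (_≡_; _≢_; _≗_; refl; sym; trans; subst)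
import Data.List.Membership.DecPropositional as DecMembership

⋀-elim : ∀ {n} {f : Fin n → Bool} → ⋀ f ≡ true → ∀ i → f i ≡ true
⋀-elim {n} {f} ⋀f i = go (allFin n) ⋀f (∈-allFin i)
  where
  go : ∀ xs → foldr (λ j b → f j ∧ b) true xs ≡ true → i ∈ xs → f i ≡ true
  go (x ∷ xs) h (here refl)  = ∧-conicalˡ _ _ h
  go (x ∷ xs) h (there i∈xs) = go xs (∧-conicalʳ _ _ h) i∈xs

⋀-intro : ∀ {n} {f : Fin n → Bool} → (∀ i → f i ≡ true) → ⋀ f ≡ true
⋀-intro {n} {f} all-true = go (allFin n)
  where
  go : ∀ xs → foldr (λ j b → f j ∧ b) true xs ≡ true
  go []       = refl
  go (x ∷ xs) rewrite all-true x = go xs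

pair : ∀ {n} → Fin n → Fin n → Config n
pair u v z = does (z ≟ u) ∨ does (z ≟ v)

module _ {n : ℕ} (u v : Fin n) where

  pair-fst : pair u v u ≡ true
  pair-fst rewrite dec-true (u ≟ u) refl = refl

  pair-snd : pair u v v ≡ true
  pair-snd rewrite dec-true (v ≟ v) refl = ∨-zeroʳ _

  pair-other : ∀ {z} → z ≢ u → z ≢ v → pair u v z ≡ false
  pair-other {z} z≢u z≢v rewrite dec-false (z ≟ u) z≢u | dec-false (z ≟ v) z≢v = refl

module _ {n : ℕ} (G : Digraph n) where

  open DecMembership (_≟_ {n}) using (_∈?_)

  Independent : Config n → Set
  Independent x = ∀ {u v} → u ⟶[ G ] v → x u ≡ true → x v ≡ true → ⊥

  I-true⇒ : ∀ {x v} → I G x v ≡ true → x v ≡ true × (∀ u → u ⟶[ G ] v → x u ≡ false)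
  I-true⇒ {x} {v} Ixv = ∧-conicalˡ _ _ Ixv , in-neighbour-off
    where
    in-neighbour-off : ∀ u → u ⟶[ G ] v → x u ≡ false
    in-neighbour-off u u⟶v = not-injective (subst (λ b → not (b ∧ x u) ≡ true) u⟶v
      (⋀-elim {f = λ u → not (edge G u v ∧ x u)} (∧-conicalʳ _ _ Ixv) u))

  I-true⇐ : ∀ {x v} → x v ≡ true → (∀ u → u ⟶[ G ] v → x u ≡ false) → I G x v ≡ true
  I-true⇐ {x} {v} xv in-neighbour-off rewrite xv = ⋀-intro not-both
    where
    not-both : ∀ u → not (edge G u v ∧ x u) ≡ true
    not-both u with edge G u v in u⟶v
    ... | false = refl
    ... | true rewrite in-neighbour-off u u⟶v = refl

  I-off : ∀ {x v} → x v ≡ false → I G x v ≡ x v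
  I-off xv rewrite xv = refl

  fixed⇒independent : ∀ {x} → IsFixed G x → Independent x
  fixed⇒independent {x} fixed {u} {v} u⟶v xu xv =
    not-¬ xu (proj₂ (I-true⇒ (trans (fixed v) xv)) u u⟶v)

  independent⇒fixed : ∀ {x} → Independent x → IsFixed G x
  independent⇒fixed {x} independent v with x v ≟ᵇ true
  ... | no xv≢true = I-off (¬-not xv≢true)
  ... | yes xv     =
    trans (I-true⇐ xv (λ u u⟶v → ¬-not (λ xu → independent u⟶v xu xv))) (sym xv)

  Iat-self : ∀ x v → Iat G v x v ≡ I G x v
  Iat-self x v rewrite dec-true (v ≟ v) refl = refl

  Iat-fixes : ∀ {x a} → I G x a ≡ x a → Iat G a x ≗ x
  Iat-fixes {a = a} Ixa z with z ≟ a
  ... | yes refl = Ixa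
  ... | no _     = refl

  Iat-decreasing : ∀ x a {z} → Iat G a x z ≡ true → x z ≡ true
  Iat-decreasing x a {z} h with z ≟ a
  ... | yes refl = proj₁ (I-true⇒ h)
  ... | no _     = h

  Iat-clears-edge : ∀ {x u v} → u ⟶[ G ] v →
    Iat G v x u ≡ true → Iat G v x v ≡ true → ⊥
  Iat-clears-edge {x} {u} {v} u⟶v x′u x′v =
    not-¬ (Iat-decreasing x v x′u) (proj₂ (I-true⇒ (trans (sym (Iat-self x v)) x′v)) u u⟶v)

  Iword-invariant : (P : Config n → Set) (w : List (Fin n)) →
    (∀ {a} → a ∈ w → ∀ {x} → P x → P (Iat G a x)) →
    ∀ {x} → P x → P (Iword G w x)
  Iword-invariant P []      step Px = Px
  Iword-invariant P (a ∷ w) step Px =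
    Iword-invariant P w (λ a∈w → step (there a∈w)) (step (here refl) Px)

  Iword-decreasing : ∀ x w {z} → Iword G w x z ≡ true → x z ≡ true
  Iword-decreasing x w {z} =
    Iword-invariant (λ y → ∀ {z} → y z ≡ true → x z ≡ true) w
      (λ {a} _ {y} y≤x x′z → y≤x (Iat-decreasing y a x′z)) (λ xz → xz)

  Iword-clears-edge : ∀ {w u v} x → v ∈ w → u ⟶[ G ] v →
    Iword G w x u ≡ true → Iword G w x v ≡ true → ⊥
  Iword-clears-edge {v ∷ w} x (here refl) u⟶v x′u x′v =
    Iat-clears-edge u⟶v (Iword-decreasing (Iat G v x) w x′u) (Iword-decreasing (Iat G v x) w x′v)
  Iword-clears-edge {a ∷ w} x (there v∈w) = Iword-clears-edge (Iat G a x) v∈w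

  cover⇒independent : ∀ {w} → IsDirectedVertexCover G (occurs w) →
    ∀ x → Independent (Iword G w x)
  cover⇒independent (symmetric , oriented) x {u} {v} u⟶v with edge G v u ≟ᵇ true
  ... | no v↛u = Iword-clears-edge x (oriented u v u⟶v v↛u) u⟶v
  ... | yes v⟶u with symmetric u v u⟶v v⟶u
  ...   | inj₂ v∈w = Iword-clears-edge x v∈w u⟶v
  ...   | inj₁ u∈w = flip (Iword-clears-edge x u∈w v⟶u)

  I-pair-tail : ∀ {x u v} → ¬ (v ⟶[ G ] u) → x ≗ pair u v → I G x u ≡ x u
  I-pair-tail {x} {u} {v} v↛u x≗pair =
    trans (I-true⇐ xu in-neighbour-off) (sym xu)
    where
    xu : x u ≡ true
    xu = trans (x≗pair u) (pair-fst u v)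
    in-neighbour-off : ∀ z → z ⟶[ G ] u → x z ≡ false
    in-neighbour-off z z⟶u = trans (x≗pair z) (pair-other u v z≢u z≢v)
      where
      z≢u : z ≢ u
      z≢u refl = not-¬ z⟶u (irrefl G z)
      z≢v : z ≢ v
      z≢v refl = v↛u z⟶u

  uncovered-edge⇒¬Fixes : ∀ {w u v} → u ⟶[ G ] v → v ∉ w →
    u ∉ w ⊎ ¬ (v ⟶[ G ] u) → ¬ Fixes w G
  uncovered-edge⇒¬Fixes {w} {u} {v} u⟶v v∉w tail-uncovered fixes =
    fixed⇒independent (fixes (pair u v)) u⟶v
      (trans (stays u) (pair-fst u v)) (trans (stays v) (pair-snd u v))
    where
    v↛u-if-updated : u ∈ w → ¬ (v ⟶[ G ] u)
    v↛u-if-updated u∈w = [ contradiction u∈w , id ] tail-uncovered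
    stable : ∀ {a x} → a ∈ w → x ≗ pair u v → I G x a ≡ x a
    stable {a} a∈w x≗pair with a ≟ u
    ... | yes refl = I-pair-tail (v↛u-if-updated a∈w) x≗pair
    ... | no a≢u   =
      I-off (trans (x≗pair a) (pair-other u v a≢u (λ { refl → v∉w a∈w })))
    stays : Iword G w (pair u v) ≗ pair u v
    stays = Iword-invariant (_≗ pair u v) w
      (λ a∈w x≗pair z → trans (Iat-fixes (stable a∈w x≗pair) z) (x≗pair z)) (λ _ → refl)

  fixes⇒cover : ∀ {w} → Fixes w G → IsDirectedVertexCover G (occurs w)
  fixes⇒cover {w} fixes = symmetric , oriented
    where
    symmetric : ∀ u v → u ⟶[ G ] v → v ⟶[ G ] u → u ∈ w ⊎ v ∈ w
    symmetric u v u⟶v _ with u ∈? w | v ∈? w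
    ... | yes u∈w | _        = inj₁ u∈w
    ... | no _    | yes v∈w  = inj₂ v∈w
    ... | no u∉w  | no v∉w   = contradiction fixes (uncovered-edge⇒¬Fixes u⟶v v∉w (inj₁ u∉w))
    oriented : ∀ u v → u ⟶[ G ] v → ¬ (v ⟶[ G ] u) → v ∈ w
    oriented u v u⟶v v↛u = decidable-stable (v ∈? w)
      (λ v∉w → uncovered-edge⇒¬Fixes u⟶v v∉w (inj₂ v↛u) fixes)

proposition7p7 : ∀ {n : ℕ} (G : Digraph n) (w : List (Fin n)) →
    Fixes w G ⇔ IsDirectedVertexCover G (occurs w)
proposition7p7 G w =
  mk⇔ (fixes⇒cover G) (λ cover x → independent⇒fixed G (cover⇒independent G cover x))
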